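{- Let $N\geq 5$ and $m=\lfloor N/2\rfloor$. Let $W_N$ be the $m\times m$ lower bidiagonal matrix with $1$ on the diagonal, $W_N(i+1,i)=F_{2i-1}/F_{2i+1}$ for $1\le i\le m-1$, and all other entries $0$; let $D_N$ be the $m\times m$ diagonal matrix with $D_N(i,i)=F_{2i+1}/F_{2i-1}$ for $1\le i\le m-1$ and $D_N(m,m)=F_N/F_{2m-1}$. Let $\vec v$ be the column vector with entries $v_k=N-2k+1$, $1\le k\le m$, and define $\vec y=(y_1,\dots,y_m)^t:=2\,{}^tW_N^{ -1}D_N^{ -1}W_N^{ -1}\vec v$. Then for every $1\le l\le m$, \[ y_l=\frac{2}{5}\left((N-2l+1)+2N\frac{(-1)^{l-1}F_{N-2l+1}}{F_N}\right). \]
   Context: $F_i$ denotes the $i$-th Fibonacci number ($F_0=0$, $F_1=1$, $F_{i+1}=F_i+F_{i-1}$). ${}^tM$ denotes the transpose of $M$. -}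

module Defs where

open import Data.Nat as ℕ using (ℕ; zero; suc; _∸_; _<_; _≟_)
open import Data.Nat.DivMod using (_/_)
open import Data.Fin using (Fin; toℕ) renaming (zero to fz; suc to fs)
open import Data.Integer using (+_)
open import Data.Rational using (ℚ; 0ℚ; 1ℚ; _+_; _*_; -_) renaming (_/_ to _/ℚ_)
open import Relation.Nullary using (yes; no)
open import Relation.Binary.PropositionalEquality using (_≡_)

F : ℕ → ℕ
F zero = 0
F (suc zero) = 1
F (suc (suc n)) = F (suc n) ℕ.+ F n

-- a / b as a rational (total: returns 0 when b = 0; only used with b ≠ 0)
divℕ : ℕ → ℕ → ℚ
divℕ a zero = 0ℚ
divℕ a (suc b) = (+ a) /ℚ (suc b)

ofℕ : ℕ → ℚ
ofℕ n = (+ n) /ℚ 1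

sgn : ℕ → ℚ
sgn zero = 1ℚ
sgn (suc k) = - sgn k

-- m × m matrices and column vectors over ℚ (0-based indices: paper index i = toℕ i + 1)
Mat : ℕ → Set
Mat m = Fin m → Fin m → ℚ

Vect : ℕ → Set
Vect m = Fin m → ℚ

sumFin : (n : ℕ) → (Fin n → ℚ) → ℚ
sumFin zero f = 0ℚ
sumFin (suc n) f = f fz + sumFin n (λ i → f (fs i))

_⊗_ : {m : ℕ} → Mat m → Mat m → Mat m
_⊗_ {m} A B i j = sumFin m (λ k → A i k * B k j)

_⊙_ : {m : ℕ} → Mat m → Vect m → Vect m
_⊙_ {m} A v i = sumFin m (λ k → A i k * v k)

transpose : {m : ℕ} → Mat m → Mat m
transpose A i j = A j i

idMat : {m : ℕ} → Mat m
idMat i j with toℕ i ≟ toℕ j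
... | yes _ = 1ℚ
... | no _ = 0ℚ

IsInverse : {m : ℕ} → Mat m → Mat m → Set
IsInverse A B = (∀ i j → (A ⊗ B) i j ≡ idMat i j) Data.Product.× (∀ i j → (B ⊗ A) i j ≡ idMat i j)
  where import Data.Product

half : ℕ → ℕ
half N = N / 2

-- W_N : 1 on diagonal, W(i+1,i) = F_{2i-1}/F_{2i+1} (paper indices); with 0-based c = i-1:
-- entry (c+1, c) = F(2c+1)/F(2c+3)
W : (N : ℕ) → Mat (half N)
W N r c with toℕ r ≟ toℕ c
... | yes _ = 1ℚ
... | no _ with toℕ r ≟ suc (toℕ c)
...   | yes _ = divℕ (F (2 ℕ.* toℕ c ℕ.+ 1)) (F (2 ℕ.* toℕ c ℕ.+ 3))
...   | no _ = 0ℚ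

D : (N : ℕ) → Mat (half N)
D N r c with toℕ r ≟ toℕ c
... | no _ = 0ℚ
... | yes _ with suc (toℕ r) ≟ half N
...   | yes _ = divℕ (F N) (F (2 ℕ.* half N ∸ 1))
...   | no _ = divℕ (F (2 ℕ.* toℕ r ℕ.+ 3)) (F (2 ℕ.* toℕ r ℕ.+ 1))

-- v_k = N - 2k + 1 ; with 0-based c = k-1: N - 2c - 1
vvec : (N : ℕ) → Vect (half N)
vvec N c = ofℕ (N ∸ 2 ℕ.* toℕ c ∸ 1)

yvec : (N : ℕ) → Mat (half N) → Mat (half N) → Vect (half N)
yvec N Winv Dinv l = ofℕ 2 * (transpose Winv ⊙ (Dinv ⊙ (Winv ⊙ vvec N))) l

-- right-hand side: (2/5)((N-2l+1) + 2N (-1)^{l-1} F_{N-2l+1} / F_N), 0-based c = l-1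
yformula : (N : ℕ) → ℕ → ℚ
yformula N c = divℕ 2 5 * (ofℕ (N ∸ 2 ℕ.* c ∸ 1)
                 + sgn c * divℕ (2 ℕ.* N ℕ.* F (N ∸ 2 ℕ.* c ∸ 1)) (F N))

-- With z = y / 2 the claim is W D ᵗW z = v. As W(c+2, c+1) D(c+1, c+1) = 1 away from the last row,
-- W D ᵗW is tridiagonal with unit off-diagonal and diagonal 2, 3, ..., 3, e, where each 3 comes from
-- F n + F (n + 4) = 3 F (n + 2) and e ∈ {2, 3} from the parity of N. Writing z_l = (t + s κ F_t) / 5 with
-- t = N - 2l + 1, s = (-1)^(l-1), κ = 2N / F_N, the interior rows hold for every κ since
-- (t + 4) + 3 (t + 2) + t = 5 (t + 2) and F_(t+4) - 3 F_(t+2) + F_t = 0, the last row by F_3 = 2 F_1 and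
-- F_4 = 3 F_2, and the first row exactly because κ F_N = 2N. Inverting W, D and ᵗW then gives y = 2z.
module Submission where

open import Defs
open import Data.Nat using (ℕ; _≤_)
open import Data.Fin using (toℕ)
open import Relation.Binary.PropositionalEquality using (_≡_)

open import Data.Nat as ℕ using (zero; suc; _<_; _∸_; _≟_; z≤n; s≤s)
import Data.Nat.Properties as ℕₚ
open import Data.Nat.DivMod using (_%_; m%n<n; m≡m%n+[m/n]*n; m/n*n≤m; /-monoˡ-≤)
open import Data.Nat.Coprimality using (1-coprimeTo) renaming (sym to coprime-sym)
open import Data.Nat.Tactic.RingSolver using (solve-∀)
open import Data.Fin using (Fin; fromℕ<) renaming (zero to fz; suc to fs)
open import Data.Fin.Properties using (toℕ<n; toℕ-fromℕ<)
import Data.Integer as ℤ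
import Data.Integer.Properties as ℤₚ
open import Data.Rational using (ℚ; mkℚ; 0ℚ; 1ℚ; _+_; _*_; -_)
open import Data.Rational.Properties hiding (_≟_)
open import Data.Rational.Solver using (module +-*-Solver)
open +-*-Solver using (solve; _:+_; _:*_; :-_; _:=_; con)
open import Data.Product using (_,_)
open import Data.Sum using (_⊎_; inj₁; inj₂)
open import Function using (_∘_; flip)
open import Relation.Binary.PropositionalEquality
open import Relation.Nullary using (yes; no; contradiction)
open import Relation.Nullary.Decidable using (dec-no)

ofℕ-mkℚ : ∀ a → ofℕ a ≡ mkℚ (ℤ.+ a) 0 (coprime-sym (1-coprimeTo a))
ofℕ-mkℚ a = normalize-coprime (coprime-sym (1-coprimeTo a))

ofℕ-+ : ∀ a b → ofℕ (a ℕ.+ b) ≡ ofℕ a + ofℕ b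
ofℕ-+ a b rewrite ofℕ-mkℚ a | ofℕ-mkℚ b | ofℕ-mkℚ (a ℕ.+ b) =
  sym (trans (/-cong {ℤ.+ a ℤ.* ℤ.+ 1 ℤ.+ ℤ.+ b ℤ.* ℤ.+ 1} {1 ℕ.* 1}
                 (trans (cong₂ ℤ._+_ (ℤₚ.*-identityʳ (ℤ.+ a)) (ℤₚ.*-identityʳ (ℤ.+ b))) (sym (ℤₚ.pos-+ a b))) refl)
             (ofℕ-mkℚ (a ℕ.+ b)))

ofℕ-* : ∀ a b → ofℕ (a ℕ.* b) ≡ ofℕ a * ofℕ b
ofℕ-* a b rewrite ofℕ-mkℚ a | ofℕ-mkℚ b | ofℕ-mkℚ (a ℕ.* b) =
  sym (trans (/-cong {ℤ.+ a ℤ.* ℤ.+ b} {1 ℕ.* 1} (sym (ℤₚ.pos-* a b)) refl) (ofℕ-mkℚ (a ℕ.* b)))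

divℕ-1-mkℚ : ∀ b → divℕ 1 (suc b) ≡ mkℚ (ℤ.+ 1) b (1-coprimeTo (suc b))
divℕ-1-mkℚ b = normalize-coprime (1-coprimeTo (suc b))

divℕ-split : ∀ a {q} → 0 < q → divℕ a q ≡ ofℕ a * divℕ 1 q
divℕ-split a {suc b} _ rewrite ofℕ-mkℚ a | divℕ-1-mkℚ b =
  /-cong (sym (ℤₚ.*-identityʳ (ℤ.+ a))) (sym (ℕₚ.*-identityˡ (suc b)))

ofℕ-*-divℕ-1 : ∀ {q} → 0 < q → ofℕ q * divℕ 1 q ≡ 1ℚ
ofℕ-*-divℕ-1 {suc b} _ rewrite ofℕ-mkℚ (suc b) | divℕ-1-mkℚ b =
  *-inverseʳ (mkℚ (ℤ.+ suc b) 0 (coprime-sym (1-coprimeTo (suc b))))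

divℕ-*-ofℕ : ∀ a {q} → 0 < q → divℕ a q * ofℕ q ≡ ofℕ a
divℕ-*-ofℕ a {q} 0<q = begin
  divℕ a q * ofℕ q             ≡⟨ cong (_* ofℕ q) (divℕ-split a 0<q) ⟩
  ofℕ a * divℕ 1 q * ofℕ q     ≡⟨ *-assoc (ofℕ a) _ _ ⟩
  ofℕ a * (divℕ 1 q * ofℕ q)   ≡⟨ cong (ofℕ a *_) (trans (*-comm _ (ofℕ q)) (ofℕ-*-divℕ-1 0<q)) ⟩
  ofℕ a * 1ℚ                   ≡⟨ *-identityʳ (ofℕ a) ⟩
  ofℕ a                        ∎
  where open ≡-Reasoning

divℕ-*ˡ : ∀ a b {q} → 0 < q → divℕ (a ℕ.* b) q ≡ divℕ a q * ofℕ b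
divℕ-*ˡ a b {q} 0<q = begin
  divℕ (a ℕ.* b) q             ≡⟨ divℕ-split (a ℕ.* b) 0<q ⟩
  ofℕ (a ℕ.* b) * divℕ 1 q     ≡⟨ cong (_* divℕ 1 q) (ofℕ-* a b) ⟩
  ofℕ a * ofℕ b * divℕ 1 q     ≡⟨ solve 3 (λ x y i → x :* y :* i := x :* i :* y) refl (ofℕ a) (ofℕ b) (divℕ 1 q) ⟩
  ofℕ a * divℕ 1 q * ofℕ b     ≡⟨ cong (_* ofℕ b) (sym (divℕ-split a 0<q)) ⟩
  divℕ a q * ofℕ b             ∎
  where open ≡-Reasoning

divℕ-*-divℕ : ∀ {p q} → 0 < p → 0 < q → divℕ p q * divℕ q p ≡ 1ℚ
divℕ-*-divℕ {p} {q} 0<p 0<q = begin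
  divℕ p q * divℕ q p                    ≡⟨ cong (divℕ p q *_) (divℕ-split q 0<p) ⟩
  divℕ p q * (ofℕ q * divℕ 1 p)          ≡⟨ sym (*-assoc (divℕ p q) _ _) ⟩
  divℕ p q * ofℕ q * divℕ 1 p            ≡⟨ cong (_* divℕ 1 p) (divℕ-*-ofℕ p 0<q) ⟩
  ofℕ p * divℕ 1 p                       ≡⟨ ofℕ-*-divℕ-1 0<p ⟩
  1ℚ                                     ∎
  where open ≡-Reasoning

divℕ-+-divℕ : ∀ {x y q} e → 0 < q → x ℕ.+ y ≡ e ℕ.* q → divℕ x q + divℕ y q ≡ ofℕ e
divℕ-+-divℕ {x} {y} {q} e 0<q x+y≡eq = begin
  divℕ x q + divℕ y q                  ≡⟨ cong₂ _+_ (divℕ-split x 0<q) (divℕ-split y 0<q) ⟩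
  ofℕ x * divℕ 1 q + ofℕ y * divℕ 1 q  ≡⟨ sym (*-distribʳ-+ (divℕ 1 q) (ofℕ x) (ofℕ y)) ⟩
  (ofℕ x + ofℕ y) * divℕ 1 q           ≡⟨ cong (_* divℕ 1 q) (trans (sym (ofℕ-+ x y)) (cong ofℕ x+y≡eq)) ⟩
  ofℕ (e ℕ.* q) * divℕ 1 q             ≡⟨ sym (divℕ-split (e ℕ.* q) 0<q) ⟩
  divℕ (e ℕ.* q) q                     ≡⟨ divℕ-*ˡ e q 0<q ⟩
  divℕ e q * ofℕ q                     ≡⟨ divℕ-*-ofℕ e 0<q ⟩
  ofℕ e                                ∎
  where open ≡-Reasoning

F-pos : ∀ {n} → 1 ≤ n → 0 < F n
F-pos {suc zero}    _ = s≤s z≤n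
F-pos {suc (suc n)} _ = ℕₚ.<-≤-trans (F-pos {suc n} (s≤s z≤n)) (ℕₚ.m≤m+n (F (suc n)) (F n))

F-2c+1-pos : ∀ c → 0 < F (2 ℕ.* c ℕ.+ 1)
F-2c+1-pos c = F-pos (ℕₚ.m≤n+m 1 (2 ℕ.* c))

F-2c+3-pos : ∀ c → 0 < F (2 ℕ.* c ℕ.+ 3)
F-2c+3-pos c = F-pos (ℕₚ.≤-trans (s≤s z≤n) (ℕₚ.m≤n+m 3 (2 ℕ.* c)))

-- The indices are taken up to an equation, as they occur in forms like 2 * r + 3 that F cannot unfold.
F-+3 : ∀ {n i j} → i ≡ 3 ℕ.+ n → j ≡ 2 ℕ.+ n → F n ℕ.+ F i ≡ 2 ℕ.* F j
F-+3 {n} refl refl = lemma (F (suc n)) (F n)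
  where
  lemma : ∀ a b → b ℕ.+ ((a ℕ.+ b) ℕ.+ a) ≡ 2 ℕ.* (a ℕ.+ b)
  lemma = solve-∀

F-+4 : ∀ {n i j} → i ≡ 4 ℕ.+ n → j ≡ 2 ℕ.+ n → F n ℕ.+ F i ≡ 3 ℕ.* F j
F-+4 {n} refl refl = lemma (F (suc n)) (F n)
  where
  lemma : ∀ a b → b ℕ.+ (((a ℕ.+ b) ℕ.+ a) ℕ.+ (a ℕ.+ b)) ≡ 3 ℕ.* (a ℕ.+ b)
  lemma = solve-∀

2r+3≡2+[2r+1] : ∀ r → 2 ℕ.* r ℕ.+ 3 ≡ 2 ℕ.+ (2 ℕ.* r ℕ.+ 1)
2r+3≡2+[2r+1] = solve-∀

sumFin-cong : ∀ n {f g : Fin n → ℚ} → (∀ i → f i ≡ g i) → sumFin n f ≡ sumFin n g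
sumFin-cong zero    f≗g = refl
sumFin-cong (suc n) f≗g = cong₂ _+_ (f≗g fz) (sumFin-cong n (f≗g ∘ fs))

sumFin-zero : ∀ n → sumFin n (λ _ → 0ℚ) ≡ 0ℚ
sumFin-zero zero    = refl
sumFin-zero (suc n) = trans (+-identityˡ _) (sumFin-zero n)

sumFin-+ : ∀ n (f g : Fin n → ℚ) → sumFin n (λ i → f i + g i) ≡ sumFin n f + sumFin n g
sumFin-+ zero    f g = sym (+-identityˡ 0ℚ)
sumFin-+ (suc n) f g rewrite sumFin-+ n (f ∘ fs) (g ∘ fs) =
  solve 4 (λ a b c d → (a :+ b) :+ (c :+ d) := (a :+ c) :+ (b :+ d)) refl
    (f fz) (g fz) (sumFin n (f ∘ fs)) (sumFin n (g ∘ fs))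

sumFin-*ˡ : ∀ n c (f : Fin n → ℚ) → c * sumFin n f ≡ sumFin n (λ i → c * f i)
sumFin-*ˡ zero    c f = *-zeroʳ c
sumFin-*ˡ (suc n) c f = trans (*-distribˡ-+ c (f fz) _) (cong (c * f fz +_) (sumFin-*ˡ n c (f ∘ fs)))

sumFin-swap : ∀ n m (h : Fin n → Fin m → ℚ) →
  sumFin n (λ i → sumFin m (h i)) ≡ sumFin m (λ k → sumFin n (λ i → h i k))
sumFin-swap zero    m h = sym (sumFin-zero m)
sumFin-swap (suc n) m h = trans (cong (sumFin m (h fz) +_) (sumFin-swap n m (h ∘ fs)))
                                (sym (sumFin-+ m (h fz) (λ k → sumFin n (λ i → h (fs i) k))))

sumFin-single : ∀ n (f : Fin n → ℚ) j → (∀ k → toℕ k ≢ toℕ j → f k ≡ 0ℚ) → sumFin n f ≡ f j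
sumFin-single (suc n) f fz h =
  trans (cong (f fz +_) (trans (sumFin-cong n (λ i → h (fs i) λ ())) (sumFin-zero n))) (+-identityʳ _)
sumFin-single (suc n) f (fs j) h =
  trans (cong₂ _+_ (h fz λ ()) (sumFin-single n (f ∘ fs) j (λ k k≢j → h (fs k) (k≢j ∘ ℕₚ.suc-injective))))
        (+-identityˡ _)

sumFin-toℕ-single : ∀ n (g : ℕ → ℚ) j → j < n → (∀ k → k < n → k ≢ j → g k ≡ 0ℚ) →
  sumFin n (λ i → g (toℕ i)) ≡ g j
sumFin-toℕ-single n g j j<n h =
  trans (sumFin-single n (g ∘ toℕ) (fromℕ< j<n)
          (λ k k≢j → h (toℕ k) (toℕ<n k) (k≢j ∘ flip trans (sym (toℕ-fromℕ< j<n)))))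
        (cong g (toℕ-fromℕ< j<n))

sumFin-toℕ-pair : ∀ n (g : ℕ → ℚ) j → suc j < n → (∀ k → k < n → k ≢ j → k ≢ suc j → g k ≡ 0ℚ) →
  sumFin n (λ i → g (toℕ i)) ≡ g j + g (suc j)
sumFin-toℕ-pair (suc n) g zero (s≤s 1≤n) h =
  cong (g 0 +_) (sumFin-toℕ-single n (g ∘ suc) 0 1≤n
    (λ k k<n k≢0 → h (suc k) (s≤s k<n) (λ ()) (k≢0 ∘ ℕₚ.suc-injective)))
sumFin-toℕ-pair (suc n) g (suc j) (s≤s j+2≤n) h =
  trans (cong₂ _+_ (h 0 (s≤s z≤n) (λ ()) (λ ()))
                   (sumFin-toℕ-pair n (g ∘ suc) j j+2≤n
                     (λ k k<n k≢j k≢j+1 → h (suc k) (s≤s k<n) (k≢j ∘ ℕₚ.suc-injective) (k≢j+1 ∘ ℕₚ.suc-injective))))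
        (+-identityˡ _)

IsLeftInverse : ∀ {m} → Mat m → Mat m → Set
IsLeftInverse A B = ∀ i j → (A ⊗ B) i j ≡ idMat i j

⊙-cong : ∀ {m} (A : Mat m) {x y : Vect m} → (∀ i → x i ≡ y i) → ∀ i → (A ⊙ x) i ≡ (A ⊙ y) i
⊙-cong {m} A x≗y i = sumFin-cong m (λ k → cong (A i k *_) (x≗y k))

⊙-⊙ : ∀ {m} (A B : Mat m) x i → (A ⊙ (B ⊙ x)) i ≡ ((A ⊗ B) ⊙ x) i
⊙-⊙ {m} A B x i = begin
  sumFin m (λ k → A i k * sumFin m (λ j → B k j * x j))
    ≡⟨ sumFin-cong m (λ k → trans (sumFin-*ˡ m (A i k) _) (sumFin-cong m (λ j → sym (*-assoc (A i k) (B k j) (x j))))) ⟩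
  sumFin m (λ k → sumFin m (λ j → A i k * B k j * x j))
    ≡⟨ sumFin-swap m m _ ⟩
  sumFin m (λ j → sumFin m (λ k → A i k * B k j * x j))
    ≡⟨ sumFin-cong m (λ j → trans (sumFin-cong m (λ k → *-comm _ (x j))) (sym (sumFin-*ˡ m (x j) _))) ⟩
  sumFin m (λ j → x j * (A ⊗ B) i j)
    ≡⟨ sumFin-cong m (λ j → *-comm (x j) _) ⟩
  sumFin m (λ j → (A ⊗ B) i j * x j) ∎
  where open ≡-Reasoning

idMat-⊙ : ∀ {m} (x : Vect m) i → (idMat ⊙ x) i ≡ x i
idMat-⊙ {m} x i = trans (sumFin-single m _ i off-diagonal) (trans (cong (_* x i) diagonal) (*-identityˡ (x i)))
  where
  off-diagonal : ∀ k → toℕ k ≢ toℕ i → idMat i k * x k ≡ 0ℚ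
  off-diagonal k k≢i rewrite dec-no (toℕ i ≟ toℕ k) (k≢i ∘ sym) = *-zeroˡ (x k)
  diagonal : idMat i i ≡ 1ℚ
  diagonal rewrite ℕₚ.≟-diag (refl {x = toℕ i}) = refl

⊙-cancel : ∀ {m} {A B : Mat m} → IsLeftInverse A B → ∀ x i → (A ⊙ (B ⊙ x)) i ≡ x i
⊙-cancel {m} {A} {B} AB≡id x i =
  trans (⊙-⊙ A B x i) (trans (sumFin-cong m (λ j → cong (_* x j) (AB≡id i j))) (idMat-⊙ x i))

idMat-sym : ∀ {m} (i j : Fin m) → idMat i j ≡ idMat j i
idMat-sym i j with toℕ i ≟ toℕ j | toℕ j ≟ toℕ i
... | yes _    | yes _    = refl
... | no _     | no _     = refl
... | yes i≡j  | no j≢i   = contradiction (sym i≡j) j≢i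
... | no i≢j   | yes j≡i  = contradiction (sym j≡i) i≢j

transpose-isLeftInverse : ∀ {m} {A B : Mat m} → IsLeftInverse B A → IsLeftInverse (transpose A) (transpose B)
transpose-isLeftInverse {m} {A} {B} BA≡id i j =
  trans (sumFin-cong m (λ k → *-comm (A k i) (B j k))) (trans (BA≡id j i) (idMat-sym j i))

⊙-⊙-⊙-inverse : ∀ {m} {A B C A′ B′ C′ : Mat m} →
  IsLeftInverse A′ A → IsLeftInverse B′ B → IsLeftInverse C′ C → ∀ {x v : Vect m} →
  (∀ i → (A ⊙ (B ⊙ (C ⊙ x))) i ≡ v i) → ∀ i → (C′ ⊙ (B′ ⊙ (A′ ⊙ v))) i ≡ x i
⊙-⊙-⊙-inverse {A = A} {B} {C} {A′} {B′} {C′} A′A≡id B′B≡id C′C≡id {x} {v} ABCx≡v i = begin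
  (C′ ⊙ (B′ ⊙ (A′ ⊙ v))) i         ≡⟨ ⊙-cong C′ (⊙-cong B′ A′v≡BCx) i ⟩
  (C′ ⊙ (B′ ⊙ (B ⊙ (C ⊙ x)))) i    ≡⟨ ⊙-cong C′ (⊙-cancel {A = B′} {B} B′B≡id (C ⊙ x)) i ⟩
  (C′ ⊙ (C ⊙ x)) i                 ≡⟨ ⊙-cancel {A = C′} {C} C′C≡id x i ⟩
  x i                              ∎
  where
  open ≡-Reasoning
  A′v≡BCx : ∀ j → (A′ ⊙ v) j ≡ (B ⊙ (C ⊙ x)) j
  A′v≡BCx j = trans (sym (⊙-cong A′ ABCx≡v j)) (⊙-cancel {A = A′} {A} A′A≡id _ j)

-- The matrices of the theorem with ℕ indices, so that neighbouring rows can be named r and suc r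

apply : (m : ℕ) → (ℕ → ℕ → ℚ) → (ℕ → ℚ) → ℕ → ℚ
apply m M x r = sumFin m (λ k → M r (toℕ k) * x (toℕ k))

⊙-toℕ : ∀ {m} (A : Mat m) (M : ℕ → ℕ → ℚ) {x : Vect m} (x′ : ℕ → ℚ) →
  (∀ i j → A i j ≡ M (toℕ i) (toℕ j)) → (∀ j → x j ≡ x′ (toℕ j)) → ∀ i → (A ⊙ x) i ≡ apply m M x′ (toℕ i)
⊙-toℕ {m} A M x′ A≗M x≗x′ i = sumFin-cong m (λ k → cong₂ _*_ (A≗M i k) (x≗x′ k))

-- a c is the paper's W_N(c+2, c+1) and d N r its D_N(r+1, r+1).
a : ℕ → ℚ
a c = divℕ (F (2 ℕ.* c ℕ.+ 1)) (F (2 ℕ.* c ℕ.+ 3))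

d : ℕ → ℕ → ℚ
d N r with suc r ≟ half N
... | yes _ = divℕ (F N) (F (2 ℕ.* half N ∸ 1))
... | no _  = divℕ (F (2 ℕ.* r ℕ.+ 3)) (F (2 ℕ.* r ℕ.+ 1))

Wᴺ : ℕ → ℕ → ℚ
Wᴺ r c with r ≟ c
... | yes _ = 1ℚ
... | no _ with r ≟ suc c
...   | yes _ = a c
...   | no _  = 0ℚ

Dᴺ : ℕ → ℕ → ℕ → ℚ
Dᴺ N r c with r ≟ c
... | yes _ = d N r
... | no _  = 0ℚ

W-toℕ : ∀ N r c → W N r c ≡ Wᴺ (toℕ r) (toℕ c)
W-toℕ N r c with toℕ r ≟ toℕ c
... | yes _ = refl
... | no _ with toℕ r ≟ suc (toℕ c)
...   | yes _ = refl
...   | no _  = refl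

D-toℕ : ∀ N r c → D N r c ≡ Dᴺ N (toℕ r) (toℕ c)
D-toℕ N r c with toℕ r ≟ toℕ c
... | no _ = refl
... | yes _ with suc (toℕ r) ≟ half N
...   | yes _ = refl
...   | no _  = refl

Wᴺ-diag : ∀ r → Wᴺ r r ≡ 1ℚ
Wᴺ-diag r rewrite ℕₚ.≟-diag (refl {x = r}) = refl

Wᴺ-sub : ∀ c → Wᴺ (suc c) c ≡ a c
Wᴺ-sub c rewrite dec-no (suc c ≟ c) ℕₚ.1+n≢n | ℕₚ.≟-diag (refl {x = suc c}) = refl

Wᴺ-off : ∀ {r c} → r ≢ c → r ≢ suc c → Wᴺ r c ≡ 0ℚ
Wᴺ-off {r} {c} r≢c r≢c+1 rewrite dec-no (r ≟ c) r≢c | dec-no (r ≟ suc c) r≢c+1 = refl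

Dᴺ-diag : ∀ N r → Dᴺ N r r ≡ d N r
Dᴺ-diag N r rewrite ℕₚ.≟-diag (refl {x = r}) = refl

Dᴺ-off : ∀ N {r c} → r ≢ c → Dᴺ N r c ≡ 0ℚ
Dᴺ-off N {r} {c} r≢c rewrite dec-no (r ≟ c) r≢c = refl

d-last : ∀ N {r} → suc r ≡ half N → d N r ≡ divℕ (F N) (F (2 ℕ.* half N ∸ 1))
d-last N r+1≡m rewrite ℕₚ.≟-diag r+1≡m = refl

d-inner : ∀ N {r} → suc r ≢ half N → d N r ≡ divℕ (F (2 ℕ.* r ℕ.+ 3)) (F (2 ℕ.* r ℕ.+ 1))
d-inner N {r} r+1≢m rewrite dec-no (suc r ≟ half N) r+1≢m = refl

Wᵀ-row : ∀ {m} (x : ℕ → ℚ) c → suc c < m → apply m (flip Wᴺ) x c ≡ x c + a c * x (suc c)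
Wᵀ-row {m} x c c+1<m =
  trans (sumFin-toℕ-pair m _ c c+1<m (λ k _ k≢c k≢c+1 → trans (cong (_* x k) (Wᴺ-off k≢c k≢c+1)) (*-zeroˡ (x k))))
        (cong₂ _+_ (trans (cong (_* x c) (Wᴺ-diag c)) (*-identityˡ (x c))) (cong (_* x (suc c)) (Wᴺ-sub c)))

Wᵀ-row-last : ∀ {m} (x : ℕ → ℚ) c → suc c ≡ m → apply m (flip Wᴺ) x c ≡ x c
Wᵀ-row-last {m} x c c+1≡m =
  trans (sumFin-toℕ-single m _ c (ℕₚ.≤-reflexive c+1≡m)
          (λ k k<m k≢c → trans (cong (_* x k) (Wᴺ-off k≢c (λ k≡c+1 → ℕₚ.<-irrefl (trans k≡c+1 c+1≡m) k<m))) (*-zeroˡ (x k))))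
        (trans (cong (_* x c) (Wᴺ-diag c)) (*-identityˡ (x c)))

D-row : ∀ N {m} (x : ℕ → ℚ) r → r < m → apply m (Dᴺ N) x r ≡ d N r * x r
D-row N {m} x r r<m =
  trans (sumFin-toℕ-single m _ r r<m (λ k _ k≢r → trans (cong (_* x k) (Dᴺ-off N (k≢r ∘ sym))) (*-zeroˡ (x k))))
        (cong (_* x r) (Dᴺ-diag N r))

W-row-zero : ∀ {m} (x : ℕ → ℚ) → 0 < m → apply m Wᴺ x 0 ≡ x 0
W-row-zero {m} x 0<m =
  trans (sumFin-toℕ-single m _ 0 0<m (λ k _ k≢0 → trans (cong (_* x k) (Wᴺ-off (k≢0 ∘ sym) λ ())) (*-zeroˡ (x k))))
        (trans (cong (_* x 0) (Wᴺ-diag 0)) (*-identityˡ (x 0)))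

W-row-suc : ∀ {m} (x : ℕ → ℚ) r → suc r < m → apply m Wᴺ x (suc r) ≡ a r * x r + x (suc r)
W-row-suc {m} x r r+1<m =
  trans (sumFin-toℕ-pair m _ r r+1<m
          (λ k _ k≢r k≢r+1 → trans (cong (_* x k) (Wᴺ-off (k≢r+1 ∘ sym) (k≢r ∘ sym ∘ ℕₚ.suc-injective))) (*-zeroˡ (x k))))
        (cong₂ _+_ (cong (_* x r) (Wᴺ-sub r)) (trans (cong (_* x (suc r)) (Wᴺ-diag (suc r))) (*-identityˡ _)))

DWᵀ : ℕ → (ℕ → ℚ) → ℕ → ℚ
DWᵀ N z = apply (half N) (Dᴺ N) (apply (half N) (flip Wᴺ) z)

WDWᵀ : ℕ → (ℕ → ℚ) → ℕ → ℚ
WDWᵀ N z = apply (half N) Wᴺ (DWᵀ N z)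

*-distrib-inverseˡ : ∀ a d x y → a * d ≡ 1ℚ → d * (x + a * y) ≡ d * x + y
*-distrib-inverseˡ a d x y a*d≡1 = begin
  d * (x + a * y)        ≡⟨ solve 4 (λ a d x y → d :* (x :+ a :* y) := d :* x :+ (a :* d) :* y) refl a d x y ⟩
  d * x + (a * d) * y    ≡⟨ cong (λ q → d * x + q * y) a*d≡1 ⟩
  d * x + 1ℚ * y         ≡⟨ cong (d * x +_) (*-identityˡ y) ⟩
  d * x + y              ∎
  where open ≡-Reasoning

*-distrib-inverseʳ : ∀ a d x y → a * d ≡ 1ℚ → a * (d * x + y) ≡ x + a * y
*-distrib-inverseʳ a d x y a*d≡1 = begin
  a * (d * x + y)        ≡⟨ solve 4 (λ a d x y → a :* (d :* x :+ y) := (a :* d) :* x :+ a :* y) refl a d x y ⟩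
  (a * d) * x + a * y    ≡⟨ cong (λ q → q * x + a * y) a*d≡1 ⟩
  1ℚ * x + a * y         ≡⟨ cong (_+ a * y) (*-identityˡ x) ⟩
  x + a * y              ∎
  where open ≡-Reasoning

a*d≡1 : ∀ N r → suc r ≢ half N → a r * d N r ≡ 1ℚ
a*d≡1 N r r+1≢m = trans (cong (a r *_) (d-inner N r+1≢m)) (divℕ-*-divℕ (F-2c+1-pos r) (F-2c+3-pos r))

-- a r + d N (r + 1) is the diagonal entry of row r + 1 of W D ᵗW.
a+d≡3 : ∀ N r → suc (suc r) ≢ half N → a r + d N (suc r) ≡ ofℕ 3
a+d≡3 N r r+2≢m =
  trans (cong (a r +_) (trans (d-inner N r+2≢m) (cong (λ i → divℕ (F (2 ℕ.* suc r ℕ.+ 3)) (F i)) (2[r+1]+1≡2r+3 r))))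
        (divℕ-+-divℕ 3 (F-2c+3-pos r) (F-+4 (2[r+1]+3≡4+[2r+1] r) (2r+3≡2+[2r+1] r)))
  where
  2[r+1]+1≡2r+3 : ∀ r → 2 ℕ.* suc r ℕ.+ 1 ≡ 2 ℕ.* r ℕ.+ 3
  2[r+1]+1≡2r+3 = solve-∀
  2[r+1]+3≡4+[2r+1] : ∀ r → 2 ℕ.* suc r ℕ.+ 3 ≡ 4 ℕ.+ (2 ℕ.* r ℕ.+ 1)
  2[r+1]+3≡4+[2r+1] = solve-∀

DWᵀ-row : ∀ N z c → suc c < half N → DWᵀ N z c ≡ d N c * z c + z (suc c)
DWᵀ-row N z c c+1<m =
  trans (D-row N {half N} _ c (ℕₚ.<-trans (ℕₚ.n<1+n c) c+1<m))
        (trans (cong (d N c *_) (Wᵀ-row z c c+1<m))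
               (*-distrib-inverseˡ (a c) (d N c) (z c) (z (suc c)) (a*d≡1 N c (ℕₚ.<⇒≢ c+1<m))))

DWᵀ-row-last : ∀ N z c → suc c ≡ half N → DWᵀ N z c ≡ d N c * z c
DWᵀ-row-last N z c c+1≡m =
  trans (D-row N {half N} _ c (ℕₚ.≤-reflexive c+1≡m)) (cong (d N c *_) (Wᵀ-row-last z c c+1≡m))

WDWᵀ-row-zero : ∀ N z → 2 ≤ half N → WDWᵀ N z 0 ≡ ofℕ 2 * z 0 + z 1
WDWᵀ-row-zero N z 2≤m =
  trans (W-row-zero {half N} (DWᵀ N z) (ℕₚ.<-trans (s≤s z≤n) 2≤m))
        (trans (DWᵀ-row N z 0 2≤m) (cong (λ q → q * z 0 + z 1) (d-inner N λ 1≡m → ℕₚ.<-irrefl 1≡m 2≤m)))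

WDWᵀ-row-suc : ∀ N z r → suc r < half N → WDWᵀ N z (suc r) ≡ z r + a r * z (suc r) + DWᵀ N z (suc r)
WDWᵀ-row-suc N z r r+1<m =
  trans (W-row-suc {half N} (DWᵀ N z) r r+1<m)
        (cong (_+ DWᵀ N z (suc r))
              (trans (cong (a r *_) (DWᵀ-row N z r r+1<m)) (*-distrib-inverseʳ (a r) (d N r) (z r) (z (suc r)) (a*d≡1 N r (ℕₚ.<⇒≢ r+1<m)))))

WDWᵀ-row-inner : ∀ N z r → suc (suc r) < half N →
  WDWᵀ N z (suc r) ≡ z r + ofℕ 3 * z (suc r) + z (suc (suc r))
WDWᵀ-row-inner N z r r+2<m = begin
  WDWᵀ N z (suc r)
    ≡⟨ WDWᵀ-row-suc N z r r+1<m ⟩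
  z r + a r * z (suc r) + DWᵀ N z (suc r)
    ≡⟨ cong (z r + a r * z (suc r) +_) (DWᵀ-row N z (suc r) r+2<m) ⟩
  z r + a r * z (suc r) + (d N (suc r) * z (suc r) + z (suc (suc r)))
    ≡⟨ solve 5 (λ x₀ x₁ x₂ α δ → x₀ :+ α :* x₁ :+ (δ :* x₁ :+ x₂) := x₀ :+ (α :+ δ) :* x₁ :+ x₂) refl
         (z r) (z (suc r)) (z (suc (suc r))) (a r) (d N (suc r)) ⟩
  z r + (a r + d N (suc r)) * z (suc r) + z (suc (suc r))
    ≡⟨ cong (λ q → z r + q * z (suc r) + z (suc (suc r))) (a+d≡3 N r (ℕₚ.<⇒≢ r+2<m)) ⟩
  z r + ofℕ 3 * z (suc r) + z (suc (suc r)) ∎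
  where
  open ≡-Reasoning
  r+1<m = ℕₚ.<-trans (ℕₚ.n<1+n (suc r)) r+2<m

-- e = 2 for even N and e = 3 for odd N.
WDWᵀ-row-last : ∀ N z r → suc (suc r) ≡ half N → ∀ e → F (2 ℕ.* r ℕ.+ 1) ℕ.+ F N ≡ e ℕ.* F (2 ℕ.* r ℕ.+ 3) →
  WDWᵀ N z (suc r) ≡ z r + ofℕ e * z (suc r)
WDWᵀ-row-last N z r r+2≡m e fib = begin
  WDWᵀ N z (suc r)
    ≡⟨ WDWᵀ-row-suc N z r (ℕₚ.≤-reflexive r+2≡m) ⟩
  z r + a r * z (suc r) + DWᵀ N z (suc r)
    ≡⟨ cong (z r + a r * z (suc r) +_) (DWᵀ-row-last N z (suc r) r+2≡m) ⟩
  z r + a r * z (suc r) + d N (suc r) * z (suc r)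
    ≡⟨ solve 4 (λ x₀ x₁ α δ → x₀ :+ α :* x₁ :+ δ :* x₁ := x₀ :+ (α :+ δ) :* x₁) refl (z r) (z (suc r)) (a r) (d N (suc r)) ⟩
  z r + (a r + d N (suc r)) * z (suc r)
    ≡⟨ cong (λ q → z r + q * z (suc r)) a+d≡e ⟩
  z r + ofℕ e * z (suc r) ∎
  where
  open ≡-Reasoning
  2[r+2]≡1+[2r+3] : ∀ r → 2 ℕ.* suc (suc r) ≡ suc (2 ℕ.* r ℕ.+ 3)
  2[r+2]≡1+[2r+3] = solve-∀
  2m-1≡2r+3 : 2 ℕ.* half N ∸ 1 ≡ 2 ℕ.* r ℕ.+ 3
  2m-1≡2r+3 = cong (_∸ 1) (trans (cong (2 ℕ.*_) (sym r+2≡m)) (2[r+2]≡1+[2r+3] r))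
  a+d≡e : a r + d N (suc r) ≡ ofℕ e
  a+d≡e = trans (cong (a r +_) (trans (d-last N r+2≡m) (cong (divℕ (F N) ∘ F) 2m-1≡2r+3)))
                (divℕ-+-divℕ e (F-2c+3-pos r) fib)

-- ζ (2N / F_N) ((-1)^(l-1)) (N - 2l + 1) is the paper's y_l / 2.
ζ : ℚ → ℚ → ℕ → ℚ
ζ κ s t = divℕ 1 5 * (ofℕ t + s * (κ * ofℕ (F t)))

ζ-expand : ∀ κ s t {T G} → ofℕ t ≡ T → ofℕ (F t) ≡ G → ζ κ s t ≡ divℕ 1 5 * (T + s * (κ * G))
ζ-expand κ s t refl refl = refl

ofℕ-F-2+ : ∀ k → ofℕ (F (2 ℕ.+ k)) ≡ ofℕ (F (suc k)) + ofℕ (F k)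
ofℕ-F-2+ k = ofℕ-+ (F (suc k)) (F k)

ofℕ-F-3+ : ∀ k → ofℕ (F (3 ℕ.+ k)) ≡ (ofℕ (F (suc k)) + ofℕ (F k)) + ofℕ (F (suc k))
ofℕ-F-3+ k = trans (ofℕ-+ (F (2 ℕ.+ k)) (F (suc k))) (cong (_+ ofℕ (F (suc k))) (ofℕ-F-2+ k))

ofℕ-F-4+ : ∀ k → ofℕ (F (4 ℕ.+ k)) ≡ ((ofℕ (F (suc k)) + ofℕ (F k)) + ofℕ (F (suc k))) + (ofℕ (F (suc k)) + ofℕ (F k))
ofℕ-F-4+ k = trans (ofℕ-+ (F (3 ℕ.+ k)) (F (2 ℕ.+ k))) (cong₂ _+_ (ofℕ-F-3+ k) (ofℕ-F-2+ k))

ζ-three-term : ∀ κ s k → ζ κ s (4 ℕ.+ k) + ofℕ 3 * ζ κ (- s) (2 ℕ.+ k) + ζ κ (- (- s)) k ≡ ofℕ (2 ℕ.+ k)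
ζ-three-term κ s k = begin
  ζ κ s (4 ℕ.+ k) + ofℕ 3 * ζ κ (- s) (2 ℕ.+ k) + ζ κ (- (- s)) k
    ≡⟨ cong₂ (λ p q → p + ofℕ 3 * q + ζ κ (- (- s)) k)
             (ζ-expand κ s (4 ℕ.+ k) (ofℕ-+ 4 k) (ofℕ-F-4+ k)) (ζ-expand κ (- s) (2 ℕ.+ k) (ofℕ-+ 2 k) (ofℕ-F-2+ k)) ⟩
  divℕ 1 5 * ((ofℕ 4 + K) + s * (κ * (((A + B) + A) + (A + B))))
    + ofℕ 3 * (divℕ 1 5 * ((ofℕ 2 + K) + (- s) * (κ * (A + B))))
    + divℕ 1 5 * (K + (- (- s)) * (κ * B))
    ≡⟨ solve 5 (λ κ s K A B →
         con (divℕ 1 5) :* ((con (ofℕ 4) :+ K) :+ s :* (κ :* (((A :+ B) :+ A) :+ (A :+ B))))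
           :+ con (ofℕ 3) :* (con (divℕ 1 5) :* ((con (ofℕ 2) :+ K) :+ (:- s) :* (κ :* (A :+ B))))
           :+ con (divℕ 1 5) :* (K :+ (:- (:- s)) :* (κ :* B))
         := con (ofℕ 2) :+ K) refl κ s K A B ⟩
  ofℕ 2 + K
    ≡⟨ sym (ofℕ-+ 2 k) ⟩
  ofℕ (2 ℕ.+ k) ∎
  where
  open ≡-Reasoning
  K = ofℕ k
  A = ofℕ (F (suc k))
  B = ofℕ (F k)

ζ-last-even : ∀ κ s → ζ κ s 3 + ofℕ 2 * ζ κ (- s) 1 ≡ ofℕ 1
ζ-last-even = solve 2 (λ κ s →
  con (divℕ 1 5) :* (con (ofℕ 3) :+ s :* (κ :* con (ofℕ 2)))
    :+ con (ofℕ 2) :* (con (divℕ 1 5) :* (con (ofℕ 1) :+ (:- s) :* (κ :* con (ofℕ 1))))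
  := con (ofℕ 1)) refl

ζ-last-odd : ∀ κ s → ζ κ s 4 + ofℕ 3 * ζ κ (- s) 2 ≡ ofℕ 2
ζ-last-odd = solve 2 (λ κ s →
  con (divℕ 1 5) :* (con (ofℕ 4) :+ s :* (κ :* con (ofℕ 3)))
    :+ con (ofℕ 3) :* (con (divℕ 1 5) :* (con (ofℕ 2) :+ (:- s) :* (κ :* con (ofℕ 1))))
  := con (ofℕ 2)) refl

ζ-first-row : ∀ κ k → κ * ofℕ (F (3 ℕ.+ k)) ≡ ofℕ (2 ℕ.* (3 ℕ.+ k)) →
  ofℕ 2 * ζ κ 1ℚ (2 ℕ.+ k) + ζ κ (- 1ℚ) k ≡ ofℕ (2 ℕ.+ k)
ζ-first-row κ k κF≡2N = begin
  ofℕ 2 * ζ κ 1ℚ (2 ℕ.+ k) + ζ κ (- 1ℚ) k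
    ≡⟨ cong (λ p → ofℕ 2 * p + ζ κ (- 1ℚ) k) (ζ-expand κ 1ℚ (2 ℕ.+ k) (ofℕ-+ 2 k) (ofℕ-F-2+ k)) ⟩
  ofℕ 2 * (divℕ 1 5 * ((ofℕ 2 + K) + 1ℚ * (κ * (A + B)))) + divℕ 1 5 * (K + (- 1ℚ) * (κ * B))
    ≡⟨ solve 4 (λ κ K A B →
         con (ofℕ 2) :* (con (divℕ 1 5) :* ((con (ofℕ 2) :+ K) :+ con 1ℚ :* (κ :* (A :+ B))))
           :+ con (divℕ 1 5) :* (K :+ (:- con 1ℚ) :* (κ :* B))
         := con (divℕ 1 5) :* (con (ofℕ 4) :+ con (ofℕ 3) :* K :+ κ :* ((A :+ B) :+ A))) refl κ K A B ⟩
  divℕ 1 5 * (ofℕ 4 + ofℕ 3 * K + κ * ((A + B) + A))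
    ≡⟨ cong (λ p → divℕ 1 5 * (ofℕ 4 + ofℕ 3 * K + p)) κF≡2[3+K] ⟩
  divℕ 1 5 * (ofℕ 4 + ofℕ 3 * K + ofℕ 2 * (ofℕ 3 + K))
    ≡⟨ solve 1 (λ K → con (divℕ 1 5) :* (con (ofℕ 4) :+ con (ofℕ 3) :* K :+ con (ofℕ 2) :* (con (ofℕ 3) :+ K))
                   := con (ofℕ 2) :+ K) refl K ⟩
  ofℕ 2 + K
    ≡⟨ sym (ofℕ-+ 2 k) ⟩
  ofℕ (2 ℕ.+ k) ∎
  where
  open ≡-Reasoning
  K = ofℕ k
  A = ofℕ (F (suc k))
  B = ofℕ (F k)
  κF≡2[3+K] : κ * ((A + B) + A) ≡ ofℕ 2 * (ofℕ 3 + K)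
  κF≡2[3+K] = trans (cong (κ *_) (sym (ofℕ-F-3+ k)))
                    (trans κF≡2N (trans (ofℕ-* 2 (3 ℕ.+ k)) (cong (ofℕ 2 *_) (ofℕ-+ 3 k))))

κ : ℕ → ℚ
κ N = divℕ (2 ℕ.* N) (F N)

z : ℕ → ℕ → ℚ
z N c = ζ (κ N) (sgn c) (N ∸ 2 ℕ.* c ∸ 1)

2*z≡yformula : ∀ {N} → 0 < F N → ∀ c → ofℕ 2 * z N c ≡ yformula N c
2*z≡yformula {N} 0<FN c =
  trans (sym (*-assoc (ofℕ 2) (divℕ 1 5) (ofℕ t + sgn c * (κ N * ofℕ (F t)))))
        (cong (λ q → divℕ 2 5 * (ofℕ t + sgn c * q)) (sym (divℕ-*ˡ (2 ℕ.* N) (F t) 0<FN)))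
  where t = N ∸ 2 ℕ.* c ∸ 1

∸-index : ∀ {N c t} → N ≡ 2 ℕ.* c ℕ.+ suc t → N ∸ 2 ℕ.* c ∸ 1 ≡ t
∸-index {c = c} {t} refl = cong (_∸ 1) (ℕₚ.m+n∸m≡n (2 ℕ.* c) (suc t))

z-index : ∀ {N c t} → N ≡ 2 ℕ.* c ℕ.+ suc t → z N c ≡ ζ (κ N) (sgn c) t
z-index {N} {c} N≡2c+1+t = cong (ζ (κ N) (sgn c)) (∸-index {c = c} N≡2c+1+t)

index-step : ∀ c j → 2 ℕ.* suc c ℕ.+ suc j ≡ 2 ℕ.* c ℕ.+ suc (2 ℕ.+ j)
index-step = solve-∀

z-row-zero : ∀ k → ofℕ 2 * z (3 ℕ.+ k) 0 + z (3 ℕ.+ k) 1 ≡ ofℕ (2 ℕ.+ k)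
z-row-zero k = ζ-first-row (κ (3 ℕ.+ k)) k (divℕ-*-ofℕ (2 ℕ.* (3 ℕ.+ k)) (F-pos {3 ℕ.+ k} (s≤s z≤n)))

z-three-term : ∀ {N r k} → N ≡ 2 ℕ.* suc (suc r) ℕ.+ suc k →
  z N r + ofℕ 3 * z N (suc r) + z N (suc (suc r)) ≡ ofℕ (N ∸ 2 ℕ.* suc r ∸ 1)
z-three-term {N} {r} {k} N≡2[r+2]+1+k = begin
  z N r + ofℕ 3 * z N (suc r) + z N (suc (suc r))
    ≡⟨ cong₂ _+_ (cong₂ (λ p q → p + ofℕ 3 * q) (z-index {c = r} N≡2r+5+k) (z-index {c = suc r} N≡2[r+1]+3+k))
                 (z-index {c = suc (suc r)} N≡2[r+2]+1+k) ⟩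
  ζ (κ N) (sgn r) (4 ℕ.+ k) + ofℕ 3 * ζ (κ N) (- sgn r) (2 ℕ.+ k) + ζ (κ N) (- (- sgn r)) k
    ≡⟨ ζ-three-term (κ N) (sgn r) k ⟩
  ofℕ (2 ℕ.+ k)
    ≡⟨ cong ofℕ (sym (∸-index {c = suc r} N≡2[r+1]+3+k)) ⟩
  ofℕ (N ∸ 2 ℕ.* suc r ∸ 1) ∎
  where
  open ≡-Reasoning
  N≡2[r+1]+3+k = trans N≡2[r+2]+1+k (index-step (suc r) k)
  N≡2r+5+k = trans N≡2[r+1]+3+k (index-step r (2 ℕ.+ k))

z-last-even : ∀ {N r} → N ≡ 2 ℕ.* suc r ℕ.+ 2 → z N r + ofℕ 2 * z N (suc r) ≡ ofℕ (N ∸ 2 ℕ.* suc r ∸ 1)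
z-last-even {N} {r} N≡2[r+1]+2 =
  trans (cong₂ (λ p q → p + ofℕ 2 * q) (z-index {c = r} (trans N≡2[r+1]+2 (index-step r 1))) (z-index {c = suc r} N≡2[r+1]+2))
        (trans (ζ-last-even (κ N) (sgn r)) (cong ofℕ (sym (∸-index {c = suc r} N≡2[r+1]+2))))

z-last-odd : ∀ {N r} → N ≡ 2 ℕ.* suc r ℕ.+ 3 → z N r + ofℕ 3 * z N (suc r) ≡ ofℕ (N ∸ 2 ℕ.* suc r ∸ 1)
z-last-odd {N} {r} N≡2[r+1]+3 =
  trans (cong₂ (λ p q → p + ofℕ 3 * q) (z-index {c = r} (trans N≡2[r+1]+3 (index-step r 2))) (z-index {c = suc r} N≡2[r+1]+3))
        (trans (ζ-last-odd (κ N) (sgn r)) (cong ofℕ (sym (∸-index {c = suc r} N≡2[r+1]+3))))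

half-parity : ∀ N → N ≡ 2 ℕ.* half N ⊎ N ≡ suc (2 ℕ.* half N)
half-parity N with N % 2 | m%n<n N 2 | m≡m%n+[m/n]*n N 2
... | 0           | _               | N≡N%2+m*2 = inj₁ (trans N≡N%2+m*2 (ℕₚ.*-comm (half N) 2))
... | 1           | _               | N≡N%2+m*2 = inj₂ (trans N≡N%2+m*2 (cong suc (ℕₚ.*-comm (half N) 2)))
... | suc (suc _) | s≤s (s≤s ())   | _

2*half≤ : ∀ N → 2 ℕ.* half N ≤ N
2*half≤ N = subst (_≤ N) (ℕₚ.*-comm (half N) 2) (m/n*n≤m N 2)

<⇒≡+suc∸ : ∀ {m n} → m < n → n ≡ m ℕ.+ suc (n ∸ suc m)
<⇒≡+suc∸ {m} {n} m<n = sym (trans (ℕₚ.+-suc m (n ∸ suc m)) (ℕₚ.m+[n∸m]≡n m<n))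

WDWᵀ-z-last : ∀ N r → suc (suc r) ≡ half N → WDWᵀ N (z N) (suc r) ≡ ofℕ (N ∸ 2 ℕ.* suc r ∸ 1)
WDWᵀ-z-last N r r+2≡m with half-parity N
... | inj₁ N≡2m =
  trans (WDWᵀ-row-last N (z N) r r+2≡m 2 (F-+3 (trans N≡2[r+2] (2[r+2]≡3+[2r+1] r)) (2r+3≡2+[2r+1] r)))
        (z-last-even (trans N≡2[r+2] (2[r+2]≡2[r+1]+2 r)))
  where
  N≡2[r+2] : N ≡ 2 ℕ.* suc (suc r)
  N≡2[r+2] = trans N≡2m (cong (2 ℕ.*_) (sym r+2≡m))
  2[r+2]≡3+[2r+1] : ∀ r → 2 ℕ.* suc (suc r) ≡ 3 ℕ.+ (2 ℕ.* r ℕ.+ 1)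
  2[r+2]≡3+[2r+1] = solve-∀
  2[r+2]≡2[r+1]+2 : ∀ r → 2 ℕ.* suc (suc r) ≡ 2 ℕ.* suc r ℕ.+ 2
  2[r+2]≡2[r+1]+2 = solve-∀
... | inj₂ N≡2m+1 =
  trans (WDWᵀ-row-last N (z N) r r+2≡m 3 (F-+4 (trans N≡2[r+2]+1 (2[r+2]+1≡4+[2r+1] r)) (2r+3≡2+[2r+1] r)))
        (z-last-odd (trans N≡2[r+2]+1 (2[r+2]+1≡2[r+1]+3 r)))
  where
  N≡2[r+2]+1 : N ≡ suc (2 ℕ.* suc (suc r))
  N≡2[r+2]+1 = trans N≡2m+1 (cong (suc ∘ (2 ℕ.*_)) (sym r+2≡m))
  2[r+2]+1≡4+[2r+1] : ∀ r → suc (2 ℕ.* suc (suc r)) ≡ 4 ℕ.+ (2 ℕ.* r ℕ.+ 1)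
  2[r+2]+1≡4+[2r+1] = solve-∀
  2[r+2]+1≡2[r+1]+3 : ∀ r → suc (2 ℕ.* suc (suc r)) ≡ 2 ℕ.* suc r ℕ.+ 3
  2[r+2]+1≡2[r+1]+3 = solve-∀

WDWᵀ-z : ∀ N → 5 ≤ N → ∀ r → r < half N → WDWᵀ N (z N) r ≡ ofℕ (N ∸ 2 ℕ.* r ∸ 1)
WDWᵀ-z .(3 ℕ.+ k) 5≤N@(s≤s (s≤s (s≤s {n = k} _))) zero _ =
  trans (WDWᵀ-row-zero (3 ℕ.+ k) (z (3 ℕ.+ k)) (/-monoˡ-≤ 2 (ℕₚ.≤-trans (ℕₚ.n≤1+n 4) 5≤N))) (z-row-zero k)
WDWᵀ-z N _ (suc r) r+1<m with ℕₚ.m≤n⇒m<n∨m≡n r+1<m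
... | inj₁ r+2<m = trans (WDWᵀ-row-inner N (z N) r r+2<m) (z-three-term (<⇒≡+suc∸ 2[r+2]<N))
  where 2[r+2]<N = ℕₚ.<-≤-trans (ℕₚ.*-monoʳ-< 2 r+2<m) (2*half≤ N)
... | inj₂ r+2≡m = WDWᵀ-z-last N r r+2≡m

lemma3p3 : (N : ℕ) → 5 ≤ N →
    (Winv Dinv : Mat (half N)) → IsInverse Winv (W N) → IsInverse Dinv (D N) →
    ∀ l → yvec N Winv Dinv l ≡ yformula N (toℕ l)
lemma3p3 N 5≤N Winv Dinv (Winv⊗W≡id , W⊗Winv≡id) (Dinv⊗D≡id , _) l = begin
  ofℕ 2 * (transpose Winv ⊙ (Dinv ⊙ (Winv ⊙ vvec N))) l
    ≡⟨ cong (ofℕ 2 *_) (⊙-⊙-⊙-inverse {A = W N} {D N} {transpose (W N)} {Winv} {Dinv} {transpose Winv}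
                          Winv⊗W≡id Dinv⊗D≡id (transpose-isLeftInverse {A = Winv} {W N} W⊗Winv≡id) WDWᵀz≡v l) ⟩
  ofℕ 2 * z N (toℕ l)
    ≡⟨ 2*z≡yformula (F-pos (ℕₚ.≤-trans (s≤s z≤n) 5≤N)) (toℕ l) ⟩
  yformula N (toℕ l) ∎
  where
  open ≡-Reasoning
  WDWᵀz≡v : ∀ i → (W N ⊙ (D N ⊙ (transpose (W N) ⊙ (z N ∘ toℕ)))) i ≡ vvec N i
  WDWᵀz≡v i =
    trans (⊙-toℕ (W N) Wᴺ (DWᵀ N (z N)) (W-toℕ N)
            (⊙-toℕ (D N) (Dᴺ N) (apply (half N) (flip Wᴺ) (z N)) (D-toℕ N)
              (⊙-toℕ (transpose (W N)) (flip Wᴺ) (z N) (flip (W-toℕ N)) (λ _ → refl))) i)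
          (WDWᵀ-z N 5≤N (toℕ i) (toℕ<n i))
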